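{- The singleton operator is expressible in $\mathsf{MLSC}$: there exists a finite conjunction $\psi(x,y,u_1,\dots,u_n)$ of $\mathsf{MLSC}$-literals, where $u_1,\dots,u_n$ are variables distinct from $x,y$, such that for all sets $X,Y$ we have $Y=\{X\}$ if and only if there exist sets $U_1,\dots,U_n$ such that the assignment $x\mapsto X$, $y\mapsto Y$, $u_i\mapsto U_i$ satisfies $\psi$.
   Context: We work in ZFC with the Axiom of Regularity. $\mathsf{MLSC}$ is the quantifier-free fragment of set theory whose terms are built from set variables and the constant $\emptyset$ using $\cup$, $\cap$, $\setminus$ and the ordered Cartesian product $\times$, where $A\times B=\{(a,b)\mid a\in A,\ b\in B\}$ with Kuratowski pairs $(a,b)=\{\{a\},\{a,b\}\}$; atoms are $s\subseteq t$, $s=t$, $s\in t$; literals are atoms and their negations; semantics is the standard set-theoretic one. -}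

module Defs where

open import Level using (0ℓ)
open import Data.Empty using (⊥; ⊥-elim)
open import Data.Unit using (⊤; tt)
open import Data.Bool using (Bool; true; false; if_then_else_)
open import Data.Sum using (_⊎_; inj₁; inj₂; [_,_])
open import Data.Product using (Σ; ∃; ∃-syntax; _×_; _,_; proj₁; proj₂)
open import Data.Nat using (ℕ; suc)
open import Data.Fin using (Fin; zero; suc)
open import Data.List using (List)
open import Data.List.Relation.Unary.All using (All)
open import Relation.Nullary using (¬_)

-- Universe of (well-founded) sets: Aczel's model of set theory.
-- A set is given by an index type and a family of elements.
-- Well-foundedness (Regularity) is built in (inductive type).

data V : Set₁ where
  sup : (I : Set) → (I → V) → V

infix 4 _≐_ _∈ᵥ_ _⊆ᵥ_
_≐_ : V → V → Set
sup I f ≐ sup J g = (∀ i → ∃[ j ] (f i ≐ g j)) × (∀ j → ∃[ i ] (f i ≐ g j))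

_∈ᵥ_ : V → V → Set
a ∈ᵥ sup I f = ∃[ i ] (a ≐ f i)

_⊆ᵥ_ : V → V → Set
sup I f ⊆ᵥ B = ∀ i → f i ∈ᵥ B

∅ᵥ : V
∅ᵥ = sup ⊥ ⊥-elim

infixl 6 _∪ᵥ_ _∖ᵥ_
infixl 7 _∩ᵥ_ _×ᵥ_

_∪ᵥ_ : V → V → V
sup I f ∪ᵥ sup J g = sup (I ⊎ J) [ f , g ]

_∩ᵥ_ : V → V → V
sup I f ∩ᵥ B = sup (Σ I (λ i → f i ∈ᵥ B)) (λ p → f (proj₁ p))

_∖ᵥ_ : V → V → V
sup I f ∖ᵥ B = sup (Σ I (λ i → ¬ (f i ∈ᵥ B))) (λ p → f (proj₁ p))

sing : V → V
sing a = sup ⊤ (λ _ → a)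

upair : V → V → V
upair a b = sup Bool (λ t → if t then a else b)

kpair : V → V → V
kpair a b = upair (sing a) (upair a b)

_×ᵥ_ : V → V → V
sup I f ×ᵥ sup J g = sup (I × J) (λ p → kpair (f (proj₁ p)) (g (proj₂ p)))

data Term (m : ℕ) : Set where
  var  : Fin m → Term m
  emp  : Term m
  _∪ₜ_ _∩ₜ_ _∖ₜ_ _×ₜ_ : Term m → Term m → Term m

data Atom (m : ℕ) : Set where
  _⊆ₐ_ _=ₐ_ _∈ₐ_ : Term m → Term m → Atom m

data Literal (m : ℕ) : Set where
  pos : Atom m → Literal m
  neg : Atom m → Literal m

⟦_⟧ₜ : ∀ {m} → Term m → (Fin m → V) → V
⟦ var i ⟧ₜ ρ = ρ i
⟦ emp ⟧ₜ ρ = ∅ᵥ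
⟦ s ∪ₜ t ⟧ₜ ρ = ⟦ s ⟧ₜ ρ ∪ᵥ ⟦ t ⟧ₜ ρ
⟦ s ∩ₜ t ⟧ₜ ρ = ⟦ s ⟧ₜ ρ ∩ᵥ ⟦ t ⟧ₜ ρ
⟦ s ∖ₜ t ⟧ₜ ρ = ⟦ s ⟧ₜ ρ ∖ᵥ ⟦ t ⟧ₜ ρ
⟦ s ×ₜ t ⟧ₜ ρ = ⟦ s ⟧ₜ ρ ×ᵥ ⟦ t ⟧ₜ ρ

⟦_⟧ₐ : ∀ {m} → Atom m → (Fin m → V) → Set
⟦ s ⊆ₐ t ⟧ₐ ρ = ⟦ s ⟧ₜ ρ ⊆ᵥ ⟦ t ⟧ₜ ρ
⟦ s =ₐ t ⟧ₐ ρ = ⟦ s ⟧ₜ ρ ≐ ⟦ t ⟧ₜ ρ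
⟦ s ∈ₐ t ⟧ₐ ρ = ⟦ s ⟧ₜ ρ ∈ᵥ ⟦ t ⟧ₜ ρ

⟦_⟧ₗ : ∀ {m} → Literal m → (Fin m → V) → Set
⟦ pos a ⟧ₗ ρ = ⟦ a ⟧ₐ ρ
⟦ neg a ⟧ₗ ρ = ¬ (⟦ a ⟧ₐ ρ)

Sat : ∀ {m} → List (Literal m) → (Fin m → V) → Set₁
Sat ψ ρ = All (λ ℓ → Lift₁ (⟦ ℓ ⟧ₗ ρ)) ψ
  where
  open import Level using (Lift)
  Lift₁ : Set → Set₁
  Lift₁ A = Lift (Level.suc 0ℓ) A

assign : ∀ {n} → V → V → (Fin n → V) → Fin (suc (suc n)) → V
assign X Y U zero = X
assign X Y U (suc zero) = Y
assign X Y U (suc (suc i)) = U i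

-- Take ψ := x ∈ y ∧ y × y ∈ u × u. The second literal says that y × y is a Kuratowski
-- pair (c , d), which has at most the two elements {c} and {c , d}. For a , b ∈ y the
-- three pairs (a , a), (a , b), (b , a) all lie in y × y, so two of them coincide, and
-- each such coincidence forces a = b. Hence y has at most one element, and x ∈ y gives
-- y = {x}. Conversely, if y = {x} then y × y = {{y}} = (y , y) ∈ u × u for u = {y}.
module Submission where

open import Defs
open import Axiom.ExcludedMiddle using (ExcludedMiddle)
open import Level using (0ℓ; lift)
open import Data.Nat using (suc)
open import Data.Fin using (zero; suc)
open import Data.List using (List; []; _∷_)
open import Data.List.Relation.Unary.All using ([]; _∷_)
open import Data.Product using (Σ; ∃-syntax; _,_; proj₁; proj₂)
open import Data.Bool using (true; false)
open import Data.Unit using (tt)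
open import Function.Bundles using (_⇔_; mk⇔)

≐-sym : ∀ {a b} → a ≐ b → b ≐ a
≐-sym {sup I f} {sup J g} (p , q) =
  (λ j → proj₁ (q j) , ≐-sym (proj₂ (q j))) ,
  (λ i → proj₁ (p i) , ≐-sym (proj₂ (p i)))

≐-trans : ∀ {a b c} → a ≐ b → b ≐ c → a ≐ c
≐-trans {sup I f} {sup J g} {sup K h} (p , q) (p′ , q′) =
  (λ i → proj₁ (p′ (proj₁ (p i))) , ≐-trans (proj₂ (p i)) (proj₂ (p′ (proj₁ (p i))))) ,
  (λ k → proj₁ (q (proj₁ (q′ k))) , ≐-trans (proj₂ (q (proj₁ (q′ k)))) (proj₂ (q′ k)))

kpair-swap⇒≐ : ∀ {a b} → kpair a b ≐ kpair b a → a ≐ b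
kpair-swap⇒≐ (p , _) with p true
... | true  , e = proj₂ (proj₁ e tt)
... | false , e = proj₂ (proj₂ e true)

kpair-diag≐kpairˡ⇒≐ : ∀ {a b} → kpair a a ≐ kpair a b → a ≐ b
kpair-diag≐kpairˡ⇒≐ (_ , q) with q false
... | true  , e = proj₂ (proj₂ e false)
... | false , e with proj₂ e false
...   | true  , e′ = e′
...   | false , e′ = e′

kpair-diag≐kpairʳ⇒≐ : ∀ {a b} → kpair a a ≐ kpair b a → a ≐ b
kpair-diag≐kpairʳ⇒≐ (_ , q) with q true
... | true  , e = proj₂ (proj₁ e tt)
... | false , e = proj₂ (proj₁ e true)

-- Pigeonhole over the two members {c} and {c , d} of kpair c d.
pairs∈kpair⇒≐ : ∀ {a b c d} →
  kpair a a ∈ᵥ kpair c d → kpair a b ∈ᵥ kpair c d → kpair b a ∈ᵥ kpair c d → a ≐ b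
pairs∈kpair⇒≐ (true  , e₁) (true  , e₂) _            = kpair-diag≐kpairˡ⇒≐ (≐-trans e₁ (≐-sym e₂))
pairs∈kpair⇒≐ (false , e₁) (false , e₂) _            = kpair-diag≐kpairˡ⇒≐ (≐-trans e₁ (≐-sym e₂))
pairs∈kpair⇒≐ (true  , e₁) (false , _)  (true  , e₃) = kpair-diag≐kpairʳ⇒≐ (≐-trans e₁ (≐-sym e₃))
pairs∈kpair⇒≐ (false , e₁) (true  , _)  (false , e₃) = kpair-diag≐kpairʳ⇒≐ (≐-trans e₁ (≐-sym e₃))
pairs∈kpair⇒≐ (true  , _)  (false , e₂) (false , e₃) = kpair-swap⇒≐ (≐-trans e₂ (≐-sym e₃))
pairs∈kpair⇒≐ (false , _)  (true  , e₂) (true  , e₃) = kpair-swap⇒≐ (≐-trans e₂ (≐-sym e₃))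

∈×⇒≐kpair : ∀ {A B C} → A ∈ᵥ B ×ᵥ C → ∃[ b ] ∃[ c ] (A ≐ kpair b c)
∈×⇒≐kpair {B = sup I f} {C = sup J g} ((i , j) , e) = f i , g j , e

AllEqual : V → Set
AllEqual (sup I f) = ∀ i j → f i ≐ f j

square≐kpair⇒AllEqual : ∀ {A c d} → A ×ᵥ A ≐ kpair c d → AllEqual A
square≐kpair⇒AllEqual {sup I f} (p , _) i j = pairs∈kpair⇒≐ (p (i , i)) (p (i , j)) (p (j , i))

AllEqual∧∈⇒≐sing : ∀ {A a} → AllEqual A → a ∈ᵥ A → A ≐ sing a
AllEqual∧∈⇒≐sing {sup I f} eq (i₀ , a≐fi₀) =
  (λ i → tt , ≐-trans (eq i i₀) (≐-sym a≐fi₀)) , (λ _ → i₀ , ≐-sym a≐fi₀)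

≐sing⇒AllEqual : ∀ {A a} → A ≐ sing a → AllEqual A
≐sing⇒AllEqual {sup I f} (p , _) i j = ≐-trans (proj₂ (p i)) (≐-sym (proj₂ (p j)))

≐sing⇒∈ : ∀ {A a} → A ≐ sing a → a ∈ᵥ A
≐sing⇒∈ {sup I f} (_ , q) = proj₁ (q tt) , ≐-sym (proj₂ (q tt))

module _ {I : Set} {f : I → V} (eq : AllEqual (sup I f)) (i₀ : I) where
  private
    A : V
    A = sup I f

    sing≐ : ∀ i → sing (f i) ≐ A
    sing≐ i = (λ _ → i₀ , eq i i₀) , (λ j → tt , eq i j)

    upair≐ : ∀ i j → upair (f i) (f j) ≐ A
    upair≐ i j = (λ { true → i₀ , eq i i₀ ; false → i₀ , eq j i₀ }) , (λ k → true , eq i k)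

    kpair≐sing : ∀ i j → kpair (f i) (f j) ≐ sing A
    kpair≐sing i j = (λ { true → tt , sing≐ i ; false → tt , upair≐ i j }) , (λ _ → true , sing≐ i)

    kpair≐upair : ∀ i j → kpair (f i) (f j) ≐ upair A A
    kpair≐upair i j = (λ { true → true , sing≐ i ; false → true , upair≐ i j }) ,
                      (λ { true → true , sing≐ i ; false → true , sing≐ i })

  AllEqual⇒square≐kpair : A ×ᵥ A ≐ kpair A A
  AllEqual⇒square≐kpair =
    (λ { (i , j) → true , kpair≐sing i j }) ,
    (λ { true → (i₀ , i₀) , kpair≐sing i₀ i₀ ; false → (i₀ , i₀) , kpair≐upair i₀ i₀ })

x y u : Term 3
x = var zero
y = var (suc zero)
u = var (suc (suc zero))

singletonFormula : List (Literal 3)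
singletonFormula = pos (x ∈ₐ y) ∷ pos ((y ×ₜ y) ∈ₐ (u ×ₜ u)) ∷ []

singletonFormula-sound : ∀ X Y U → Sat singletonFormula (assign {1} X Y U) → Y ≐ sing X
singletonFormula-sound X Y U (lift X∈Y ∷ lift Y²∈U² ∷ []) with ∈×⇒≐kpair {B = U zero} Y²∈U²
... | _ , _ , Y²≐kpair = AllEqual∧∈⇒≐sing (square≐kpair⇒AllEqual Y²≐kpair) X∈Y

singletonFormula-complete : ∀ X Y → Y ≐ sing X → Sat singletonFormula (assign {1} X Y (λ _ → sing Y))
singletonFormula-complete X (sup I f) Y≐singX =
  lift X∈Y ∷ lift ((tt , tt) , AllEqual⇒square≐kpair (≐sing⇒AllEqual Y≐singX) (proj₁ X∈Y)) ∷ []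
  where
  X∈Y : X ∈ᵥ sup I f
  X∈Y = ≐sing⇒∈ Y≐singX

-- The construction is constructive.
mainTheorem2 : ExcludedMiddle 0ℓ →
    ∃[ n ] Σ (List (Literal (suc (suc n)))) (λ ψ →
    (X Y : V) → (Y ≐ sing X) ⇔ (∃[ U ] Sat ψ (assign {n} X Y U)))
mainTheorem2 _ = 1 , singletonFormula , λ X Y →
  mk⇔ (λ Y≐singX → (λ _ → sing Y) , singletonFormula-complete X Y Y≐singX)
      (λ { (U , sat) → singletonFormula-sound X Y U sat })
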